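{- For every positive integer $n$, the complete graph $K_n$ satisfies: (1) $K_n\in\mathfrak{T}$; (2) $w_\tau(K_n)=n$ if $n$ is odd, and $w_\tau(K_n)=\frac{3}{2}n$ if $n$ is even; (3) $W_\tau(K_n)=2n-1$.
   Context: All graphs are finite, undirected, without loops or multiple edges. A total coloring of a graph $G$ is an assignment of colors to the vertices and edges of $G$ such that no two adjacent vertices, no two adjacent edges, and no vertex and an edge incident to it receive the same color. For a positive integer $t$, an interval total $t$-coloring of $G$ is a total coloring of $G$ with colors $1,2,\ldots,t$ such that each color $i\in\{1,\ldots,t\}$ is used on at least one vertex or edge, and for each vertex $v$ the set consisting of the color of $v$ and the colors of the edges incident to $v$ consists of $d_G(v)+1$ consecutive integers, where $d_G(v)$ is the degree of $v$. $\mathfrak{T}_t$ denotes the set of graphs having an interval total $t$-coloring, and $\mathfrak{T}=\bigcup_{t\geq 1}\mathfrak{T}_t$. For $G\in\mathfrak{T}$, $w_\tau(G)$ and $W_\tau(G)$ denote the least and the greatest $t$ such that $G\in\mathfrak{T}_t$. -}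

module Defs where

open import Data.Nat using (ℕ; zero; suc; _+_; _≤_; _<_)
open import Data.Fin using (Fin)
open import Data.Fin.Properties using (_≟_)
open import Data.List using (List; length; filter; allFin)
open import Data.Product using (Σ; ∃; _×_; _,_)
open import Data.Sum using (_⊎_)
open import Relation.Nullary using (¬_; Dec; ¬?)
open import Relation.Binary.PropositionalEquality as Eq using (_≡_; refl)

record Graph (n : ℕ) : Set₁ where
  field
    Adj      : Fin n → Fin n → Set
    adj?     : ∀ u v → Dec (Adj u v)
    irrefl   : ∀ v → ¬ Adj v v
    sym      : ∀ {u v} → Adj u v → Adj v u

open Graph public

degree : ∀ {n} (G : Graph n) → Fin n → ℕ
degree G v = length (filter (λ u → adj? G v u) (allFin _))

K : (n : ℕ) → Graph n
K n = record
  { Adj    = λ u v → ¬ (u ≡ v)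
  ; adj?   = λ u v → ¬? (u ≟ v)
  ; irrefl = λ v p → p refl
  ; sym    = λ p q → p (Eq.sym q)
  }

record TotalColoring {n : ℕ} (G : Graph n) : Set where
  field
    vcol   : Fin n → ℕ
    ecol   : ∀ u v → Adj G u v → ℕ
    ecol-sym : ∀ u v (p : Adj G u v) (q : Adj G v u) → ecol u v p ≡ ecol v u q
    v-proper : ∀ u v → Adj G u v → ¬ (vcol u ≡ vcol v)
    e-proper : ∀ v u w (p : Adj G v u) (q : Adj G v w) →
               ¬ (u ≡ w) → ¬ (ecol v u p ≡ ecol v w q)
    ve-proper : ∀ v u (p : Adj G v u) → ¬ (vcol v ≡ ecol v u p)

open TotalColoring public

AtVertex : ∀ {n} {G : Graph n} → TotalColoring G → Fin n → ℕ → Set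
AtVertex {G = G} c v k = (vcol c v ≡ k) ⊎ (∃ λ u → Σ (Adj G v u) λ p → ecol c v u p ≡ k)

Used : ∀ {n} {G : Graph n} → TotalColoring G → ℕ → Set
Used {G = G} c k = (∃ λ v → vcol c v ≡ k) ⊎
                   (∃ λ u → ∃ λ v → Σ (Adj G u v) λ p → ecol c u v p ≡ k)

record IntervalTotalColoring {n : ℕ} (G : Graph n) (t : ℕ) : Set where
  field
    col      : TotalColoring G
    v-range  : ∀ v → 1 ≤ vcol col v × vcol col v ≤ t
    e-range  : ∀ u v (p : Adj G u v) → 1 ≤ ecol col u v p × ecol col u v p ≤ t
    all-used : ∀ k → 1 ≤ k → k ≤ t → Used col k
    interval : ∀ v → ∃ λ a → ∀ k →
               (AtVertex col v k → a ≤ k × k ≤ a + degree G v) ×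
               (a ≤ k → k ≤ a + degree G v → AtVertex col v k)

InT : ∀ {n} → Graph n → ℕ → Set
InT G t = IntervalTotalColoring G t

-- A vertex of K_n sees n consecutive colors, so t ≥ n.  If the colors 1 and t
-- occur at x and y, the color of the edge xy lies in both spectra, so t ≤ 2n − 1.  For n = 2k let
-- d = t − n: every spectrum starts at most at d + 1, so each color in (d, n] is seen at every vertex.
-- Such a color is not a vertex color, for then the edges of that color would pair off the other
-- n − 1 vertices, an odd number.  So the n distinct vertex colors lie in [1, d] ∪ (n, n + d], whence
-- n ≤ 2d and t ≥ 3k.
-- Upper bounds.  Number the vertices 0, …, n − 1 and color vertex i by f(2i) and edge ij by f(i + j):
-- f(x) = x + 1 uses 2n − 1 colors, f(x) = 1 + (x mod n) uses n colors for odd n, and a suitable f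
-- uses 3k colors for n = 2k.

module Submission where

open import Defs hiding (sym)
open import Data.Nat using (ℕ; zero; suc; _+_; _*_; _≤_; _<_; _∸_; z≤n; s≤s; _≤?_; _<?_) renaming (_≟_ to _≟ℕ_)
open import Data.Nat.Properties hiding (_≟_)
open import Data.Fin as Fin using (Fin; toℕ; fromℕ<; punchOut)
open import Data.Fin.Properties using (_≟_; any?; toℕ-injective; toℕ-fromℕ<; toℕ≤pred[n]; punchOut-injective; injective⇒≤)
open import Data.List using (List; []; _∷_; length; filter; allFin)
open import Data.List.Properties using (length-tabulate; filter-all; filter-accept; filter-reject)
open import Data.List.Membership.Propositional using (_∈_)
open import Data.List.Membership.Propositional.Properties using (∈-filter⁺; ∈-filter⁻; ∈-allFin)
open import Data.List.Relation.Unary.Any using (here; there)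
open import Data.List.Relation.Unary.All as All using (_∷_)
open import Data.List.Relation.Unary.Unique.Propositional using (Unique)
open import Data.List.Relation.Unary.AllPairs using (_∷_)
import Data.List.Relation.Unary.Unique.Propositional.Properties as Unique
open import Data.Product using (Σ; ∃; _×_; _,_; proj₁; proj₂; map₂)
open import Function using (id)
open import Data.Sum using (_⊎_; inj₁; inj₂)
open import Function.Definitions using (Injective)
open import Induction.WellFounded using (Acc; acc)
open import Data.Nat.Induction using (<-wellFounded)
open import Relation.Nullary using (yes; no; ¬?; contradiction)
open import Relation.Binary using (DecidableEquality; tri<; tri≈; tri>)
open import Relation.Binary.PropositionalEquality
open import Data.Nat.Tactic.RingSolver using (solve-∀)

odd≢even : ∀ j k → suc (j + j) ≢ k + k
odd≢even zero    (suc k) eq = 0≢1+n (trans (suc-injective eq) (+-suc k k))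
odd≢even (suc j) (suc k) eq rewrite +-suc j j | +-suc k k = odd≢even j k (suc-injective (suc-injective eq))

double-≤⇒≤ : ∀ {a b} → a + a ≤ b + b → a ≤ b
double-≤⇒≤ {a} {b} le with a ≤? b
... | yes a≤b = a≤b
... | no  a≰b = contradiction le (<⇒≱ (+-mono-< (≰⇒> a≰b) (≰⇒> a≰b)))

double-<⇒< : ∀ {a b} → a + a < b + b → a < b
double-<⇒< {a} {b} lt with a <? b
... | yes a<b = a<b
... | no  a≮b = contradiction lt (≤⇒≯ (+-mono-≤ (≮⇒≥ a≮b) (≮⇒≥ a≮b)))

3k≡k+k+k : ∀ k → 3 * k ≡ k + k + k
3k≡k+k+k = solve-∀

distinct-on-<⇒injective : ∀ {m} (g : ℕ → ℕ) → (∀ {i j} → i < j → j ≤ m → g i ≢ g j) →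
                          ∀ {i j} → i ≤ m → j ≤ m → g i ≡ g j → i ≡ j
distinct-on-<⇒injective g distinct {i} {j} i≤m j≤m eq with <-cmp i j
... | tri< i<j _ _ = contradiction eq (distinct i<j j≤m)
... | tri≈ _ i≡j _ = i≡j
... | tri> _ _ j<i = contradiction (sym eq) (distinct j<i i≤m)

module ListWithout {A : Set} (_≟ᴬ_ : DecidableEquality A) where

  _without_ : List A → A → List A
  xs without w = filter (λ u → ¬? (w ≟ᴬ u)) xs

  length-without : ∀ {w} xs → Unique xs → w ∈ xs → length xs ≡ suc (length (xs without w))
  length-without {w} (x ∷ xs) (x∉xs ∷ _) (here refl) =
    cong (λ ys → suc (length ys)) (sym (trans (filter-reject (λ u → ¬? (w ≟ᴬ u)) (λ w≢w → w≢w refl))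
                                     (filter-all (λ u → ¬? (w ≟ᴬ u)) x∉xs)))
  length-without {w} (x ∷ xs) (x∉xs ∷ uniq) (there w∈xs) =
    cong suc (trans (length-without xs uniq w∈xs)
      (cong length (sym (filter-accept (λ u → ¬? (w ≟ᴬ u)) (λ w≡x → All.lookup x∉xs w∈xs (sym w≡x))))))

  even-length-of-involution : (g : A → A) (xs : List A) → Unique xs →
    (∀ {x} → x ∈ xs → g x ∈ xs) → (∀ {x} → x ∈ xs → g x ≢ x) → (∀ {x} → x ∈ xs → g (g x) ≡ x) →
    ∃ λ j → length xs ≡ j + j
  even-length-of-involution g xs₀ = go xs₀ (<-wellFounded (length xs₀))
    where
    go : ∀ xs → Acc _<_ (length xs) → Unique xs →
         (∀ {x} → x ∈ xs → g x ∈ xs) → (∀ {x} → x ∈ xs → g x ≢ x) → (∀ {x} → x ∈ xs → g (g x) ≡ x) →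
         ∃ λ j → length xs ≡ j + j
    go []       _        _                  _      _        _   = 0 , refl
    go (y ∷ ys) (acc rs) (y∉ys ∷ uniq) closed no-fixed inv = suc j , length-eq
      where
      gy∈ys : g y ∈ ys
      gy∈ys with closed (here refl)
      ... | here gy≡y  = contradiction gy≡y (no-fixed (here refl))
      ... | there gy∈ = gy∈
      rest = ys without g y
      length-rest : length ys ≡ suc (length rest)
      length-rest = length-without ys uniq gy∈ys
      member : ∀ {x} → x ∈ rest → x ∈ ys × g y ≢ x
      member = ∈-filter⁻ (λ u → ¬? (g y ≟ᴬ u))
      closed-rest : ∀ {x} → x ∈ rest → g x ∈ rest
      closed-rest {x} x∈rest = ∈-filter⁺ (λ u → ¬? (g y ≟ᴬ u)) gx∈ys gy≢gx
        where
        x∈ys = proj₁ (member x∈rest)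
        gy≢gx : g y ≢ g x
        gy≢gx gy≡gx = All.lookup y∉ys x∈ys
          (trans (sym (inv (here refl))) (trans (cong g gy≡gx) (inv (there x∈ys))))
        gx∈ys : g x ∈ ys
        gx∈ys with closed (there x∈ys)
        ... | here gx≡y  = contradiction (trans (cong g (sym gx≡y)) (inv (there x∈ys))) (proj₂ (member x∈rest))
        ... | there gx∈ = gx∈
      ih : ∃ λ j → length rest ≡ j + j
      ih = go rest (rs (s≤s (≤-trans (n≤1+n _) (≤-reflexive (sym length-rest)))))
             (Unique.filter⁺ (λ u → ¬? (g y ≟ᴬ u)) uniq) closed-rest
             (λ x∈ → no-fixed (there (proj₁ (member x∈)))) (λ x∈ → inv (there (proj₁ (member x∈))))
      j = proj₁ ih
      length-eq : suc (length ys) ≡ suc j + suc j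
      length-eq = cong suc (trans length-rest (trans (cong suc (proj₂ ih)) (sym (+-suc j j))))

injective-bounded⇒≤ : ∀ {n} M (f : Fin n → ℕ) → Injective _≡_ _≡_ f → (∀ x → f x < M) → n ≤ M
injective-bounded⇒≤ M f f-inj f<M = injective⇒≤ {f = λ x → fromℕ< (f<M x)} λ {x} {y} eq →
  f-inj (trans (sym (toℕ-fromℕ< (f<M x))) (trans (cong toℕ eq) (toℕ-fromℕ< (f<M y))))

injective-into-interval⇒onto : ∀ {m} a (f : Fin (suc m) → ℕ) → Injective _≡_ _≡_ f →
  (∀ x → a ≤ f x × f x ≤ a + m) → ∀ c → a ≤ c → c ≤ a + m → ∃ λ x → f x ≡ c
injective-into-interval⇒onto {m} a f f-inj f-range c a≤c c≤a+m with any? (λ x → f x ≟ℕ c)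
... | yes hit  = hit
... | no  miss = contradiction (injective⇒≤ punched-injective) 1+n≰n
  where
  slot : ∀ {y} → y ≤ a + m → Fin (suc m)
  slot {y} y≤a+m = fromℕ< (s≤s (m≤n+o⇒m∸n≤o y a y≤a+m))
  slot-injective : ∀ {y z} → a ≤ y → a ≤ z → (p : y ≤ a + m) (q : z ≤ a + m) → slot p ≡ slot q → y ≡ z
  slot-injective a≤y a≤z p q eq =
    ∸-cancelʳ-≡ a≤y a≤z (trans (sym (toℕ-fromℕ< _)) (trans (cong toℕ eq) (toℕ-fromℕ< _)))
  c≢f : ∀ x → slot c≤a+m ≢ slot (proj₂ (f-range x))
  c≢f x eq = miss (x , sym (slot-injective a≤c (proj₁ (f-range x)) c≤a+m (proj₂ (f-range x)) eq))
  punched-injective : Injective _≡_ _≡_ (λ x → punchOut (c≢f x))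
  punched-injective {x} {y} eq = f-inj (slot-injective (proj₁ (f-range x)) (proj₁ (f-range y))
                                          (proj₂ (f-range x)) (proj₂ (f-range y))
                                          (punchOut-injective (c≢f x) (c≢f y) eq))

injective-outside-gap⇒≤ : ∀ {n} d (f : Fin n → ℕ) → Injective _≡_ _≡_ f →
  (∀ x → 1 ≤ f x × f x ≤ n + d) → (∀ x → f x ≤ d ⊎ n < f x) → n ≤ d + d
injective-outside-gap⇒≤ {n} d f f-inj f-range outside =
  injective-bounded⇒≤ (d + d) (λ x → squeeze (outside x)) squeeze-injective (λ x → squeeze-< x (outside x))
  where
  squeeze : ∀ {y} → y ≤ d ⊎ n < y → ℕ
  squeeze {y} (inj₁ _) = y ∸ 1
  squeeze {y} (inj₂ _) = y ∸ suc n + d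
  low<d : ∀ x → f x ≤ d → f x ∸ 1 < d
  low<d x fx≤d = ≤-trans (≤-reflexive (m+[n∸m]≡n (proj₁ (f-range x)))) fx≤d
  squeeze-< : ∀ x (side : f x ≤ d ⊎ n < f x) → squeeze side < d + d
  squeeze-< x (inj₁ fx≤d) = ≤-trans (low<d x fx≤d) (m≤m+n d d)
  squeeze-< x (inj₂ n<fx) = +-monoˡ-< d (subst (f x ∸ suc n <_) (m+n∸m≡n (suc n) d)
                                            (∸-monoˡ-< (s≤s (proj₂ (f-range x))) n<fx))
  squeeze-injective : Injective _≡_ _≡_ (λ x → squeeze (outside x))
  squeeze-injective {x} {y} eq with outside x | outside y
  ... | inj₁ _    | inj₁ _    = f-inj (∸-cancelʳ-≡ (proj₁ (f-range x)) (proj₁ (f-range y)) eq)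
  ... | inj₂ n<fx | inj₂ n<fy = f-inj (∸-cancelʳ-≡ n<fx n<fy (+-cancelʳ-≡ d _ _ eq))
  ... | inj₁ fx≤d | inj₂ _    = contradiction eq (<⇒≢ (<-≤-trans (low<d x fx≤d) (m≤n+m d _)))
  ... | inj₂ _    | inj₁ fy≤d = contradiction (sym eq) (<⇒≢ (<-≤-trans (low<d y fy≤d) (m≤n+m d _)))

open module FinListWithout {n} = ListWithout (_≟_ {n})

degree-K : ∀ {m} (v : Fin (suc m)) → degree (K (suc m)) v ≡ m
degree-K {m} v = suc-injective (begin
  suc (degree (K (suc m)) v)  ≡⟨ sym (length-without (allFin (suc m)) (Unique.allFin⁺ (suc m)) (∈-allFin v)) ⟩
  length (allFin (suc m))     ≡⟨ length-tabulate id ⟩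
  suc m                       ∎)
  where open ≡-Reasoning

module IntervalTotalColoringOfK {m t : ℕ} (φ : InT (K (suc m)) t) where
  open IntervalTotalColoring φ

  base : Fin (suc m) → ℕ
  base v = proj₁ (interval v)

  spectrum-⊆ : ∀ v {k} → AtVertex col v k → base v ≤ k × k ≤ base v + m
  spectrum-⊆ v {k} k-at-v with proj₁ (proj₂ (interval v) k) k-at-v
  ... | base≤k , k≤end = base≤k , subst (λ d → k ≤ base v + d) (degree-K v) k≤end

  spectrum-⊇ : ∀ v {k} → base v ≤ k → k ≤ base v + m → AtVertex col v k
  spectrum-⊇ v {k} base≤k k≤end =
    proj₂ (proj₂ (interval v) k) base≤k (subst (λ d → k ≤ base v + d) (sym (degree-K v)) k≤end)

  AtVertex-range : ∀ v {k} → AtVertex col v k → 1 ≤ k × k ≤ t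
  AtVertex-range v (inj₁ refl)              = v-range v
  AtVertex-range v (inj₂ (u , v≢u , refl)) = e-range v u v≢u

  base-range : ∀ v → 1 ≤ base v × base v + m ≤ t
  base-range v = proj₁ (AtVertex-range v (spectrum-⊇ v ≤-refl (m≤m+n _ m))) ,
                  proj₂ (AtVertex-range v (spectrum-⊇ v (m≤m+n _ m) ≤-refl))

  n≤t : suc m ≤ t
  n≤t = ≤-trans (+-monoˡ-≤ m (proj₁ (base-range Fin.zero))) (proj₂ (base-range Fin.zero))

  base≤base+m : ∀ u v → base v ≤ base u + m
  base≤base+m u v with u ≟ v
  ... | yes refl = m≤m+n _ m
  ... | no  u≢v  = begin
    base v                   ≤⟨ proj₁ (spectrum-⊆ v (inj₂ (u , ≢-sym u≢v , refl))) ⟩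
    ecol col v u (≢-sym u≢v) ≡⟨ ecol-sym col v u (≢-sym u≢v) u≢v ⟩
    ecol col u v u≢v         ≤⟨ proj₂ (spectrum-⊆ u (inj₂ (v , u≢v , refl))) ⟩
    base u + m               ∎
    where open ≤-Reasoning

  Used⇒AtVertex : ∀ {k} → Used col k → ∃ λ v → AtVertex col v k
  Used⇒AtVertex (inj₁ (v , eq))          = v , inj₁ eq
  Used⇒AtVertex (inj₂ (u , v , p , eq)) = u , inj₂ (v , p , eq)

  t≤2n∸1 : t ≤ suc (m + m)
  t≤2n∸1 with Used⇒AtVertex (all-used 1 ≤-refl 1≤t) | Used⇒AtVertex (all-used t 1≤t ≤-refl)
    where 1≤t = ≤-trans (s≤s z≤n) n≤t
  ... | x , 1-at-x | y , t-at-y = begin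
    t                ≤⟨ proj₂ (spectrum-⊆ y t-at-y) ⟩
    base y + m      ≤⟨ +-monoˡ-≤ m (base≤base+m x y) ⟩
    base x + m + m  ≤⟨ +-monoˡ-≤ m (+-monoˡ-≤ m (proj₁ (spectrum-⊆ x 1-at-x))) ⟩
    suc (m + m)      ∎
    where open ≤-Reasoning

  module ColorMatching (x : Fin (suc m)) (everywhere : ∀ v → AtVertex col v (vcol col x)) where
    c = vcol col x

    partner-at : ∀ v → AtVertex col v c → Fin (suc m)
    partner-at v (inj₁ _)       = v
    partner-at v (inj₂ (u , _)) = u

    partner : Fin (suc m) → Fin (suc m)
    partner v = partner-at v (everywhere v)

    partner-edge : ∀ v → x ≢ v → Σ (v ≢ partner v) λ p → ecol col v (partner v) p ≡ c
    partner-edge v x≢v with everywhere v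
    ... | inj₁ cv≡c          = contradiction (sym cv≡c) (v-proper col x v x≢v)
    ... | inj₂ (u , v≢u , e) = v≢u , e

    x≢partner : ∀ v → x ≢ v → x ≢ partner v
    x≢partner v x≢v = not-x (partner v) (partner-edge v x≢v)
      where
      not-x : ∀ u → Σ (v ≢ u) (λ p → ecol col v u p ≡ c) → x ≢ u
      not-x u (v≢u , e) refl = ve-proper col x v x≢v (sym (trans (ecol-sym col x v x≢v v≢u) e))

    partner-involutive : ∀ v → x ≢ v → partner (partner v) ≡ v
    partner-involutive v x≢v with partner (partner v) ≟ v
    ... | yes eq = eq
    ... | no  ≢v = contradiction (trans e₂ (sym (trans (ecol-sym col u v (≢-sym p) p) e₁)))
                                 (e-proper col u (partner u) v q (≢-sym p) ≢v)
      where
      u = partner v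
      p = proj₁ (partner-edge v x≢v)
      e₁ = proj₂ (partner-edge v x≢v)
      q = proj₁ (partner-edge u (x≢partner v x≢v))
      e₂ = proj₂ (partner-edge u (x≢partner v x≢v))

  vertex-color-everywhere⇒m-even : ∀ x → (∀ v → AtVertex col v (vcol col x)) → ∃ λ j → m ≡ j + j
  vertex-color-everywhere⇒m-even x everywhere =
    map₂ (trans (sym (degree-K x)))
      (even-length-of-involution partner (allFin (suc m) without x)
        (Unique.filter⁺ (λ u → ¬? (x ≟ u)) (Unique.allFin⁺ (suc m)))
        (λ {v} v∈ → ∈-filter⁺ (λ u → ¬? (x ≟ u)) (∈-allFin (partner v)) (x≢partner v (x≢ v∈)))
        (λ {v} v∈ eq → proj₁ (partner-edge v (x≢ v∈)) (sym eq))
        (λ {v} v∈ → partner-involutive v (x≢ v∈)))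
    where
    open ColorMatching x everywhere
    x≢_ : ∀ {v} → v ∈ allFin (suc m) without x → x ≢ v
    x≢ v∈ = proj₂ (∈-filter⁻ (λ u → ¬? (x ≟ u)) {xs = allFin (suc m)} v∈)

  vcol-injective : Injective _≡_ _≡_ (vcol col)
  vcol-injective {x} {y} eq with x ≟ y
  ... | yes x≡y = x≡y
  ... | no  x≢y = contradiction eq (v-proper col x y x≢y)

  even⇒3k≤t : ∀ k → suc m ≡ 2 * k → 3 * k ≤ t
  even⇒3k≤t k n≡2k = begin
    3 * k        ≡⟨ 3k≡k+k+k k ⟩
    k + k + k    ≤⟨ +-mono-≤ (≤-reflexive (sym n≡k+k)) k≤d ⟩
    suc m + d    ≡⟨ m+[n∸m]≡n n≤t ⟩
    t            ∎
    where
    open ≤-Reasoning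
    d = t ∸ suc m
    n≡k+k : suc m ≡ k + k
    n≡k+k = trans n≡2k (cong (k +_) (+-identityʳ k))
    everywhere : ∀ c → d < c → c ≤ suc m → ∀ v → AtVertex col v c
    everywhere c d<c c≤n v = spectrum-⊇ v (≤-trans base≤1+d d<c) (≤-trans c≤n (+-monoˡ-≤ m (proj₁ (base-range v))))
      where
      base≤1+d : base v ≤ suc d
      base≤1+d = +-cancelʳ-≤ m (base v) (suc d) (≤-trans (proj₂ (base-range v))
                    (≤-reflexive (trans (sym (m+[n∸m]≡n n≤t)) (cong suc (+-comm m d)))))
    outside : ∀ x → vcol col x ≤ d ⊎ suc m < vcol col x
    outside x with vcol col x ≤? d | suc m <? vcol col x
    ... | yes ≤d | _       = inj₁ ≤d
    ... | no _   | yes n<  = inj₂ n<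
    ... | no ≰d  | no n≮ with vertex-color-everywhere⇒m-even x (everywhere _ (≰⇒> ≰d) (≮⇒≥ n≮))
    ...   | j , m≡j+j = contradiction (trans (cong suc (sym m≡j+j)) n≡k+k) (odd≢even j k)
    n≤d+d : suc m ≤ d + d
    n≤d+d = injective-outside-gap⇒≤ d (vcol col) vcol-injective
              (λ x → proj₁ (v-range x) , ≤-trans (proj₂ (v-range x)) (≤-reflexive (sym (m+[n∸m]≡n n≤t))))
              outside
    k≤d : k ≤ d
    k≤d = double-≤⇒≤ (subst (_≤ d + d) n≡k+k n≤d+d)

-- Vertex i is colored f (i + i) and the edge ij is colored f (i + j), so vertex v sees the
-- values of f on the window [v, v + m].
record SumColoring (m t : ℕ) : Set where
  field
    f                 : ℕ → ℕ
    base              : ℕ → ℕ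
    window-distinct   : ∀ v x y → v ≤ m → v ≤ x → x < y → y ≤ v + m → f x ≢ f y
    window-range      : ∀ v x → v ≤ m → v ≤ x → x ≤ v + m → base v ≤ f x × f x ≤ base v + m
    diagonal-distinct : ∀ i j → i < j → j ≤ m → f (i + i) ≢ f (j + j)
    base-range        : ∀ v → v ≤ m → 1 ≤ base v × base v + m ≤ t
    covered           : ∀ c → 1 ≤ c → c ≤ t → ∃ λ v → v ≤ m × base v ≤ c × c ≤ base v + m

module FromSumColoring {m t : ℕ} (S : SumColoring m t) where
  open SumColoring S

  toℕ≤m : ∀ (v : Fin (suc m)) → toℕ v ≤ m
  toℕ≤m = toℕ≤pred[n]

  row : Fin (suc m) → Fin (suc m) → ℕ
  row v u = f (toℕ v + toℕ u)

  row-injective : ∀ v → Injective _≡_ _≡_ (row v)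
  row-injective v {u} {w} eq = toℕ-injective (distinct-on-<⇒injective (λ x → f (toℕ v + x))
    (λ x<y y≤m → window-distinct (toℕ v) _ _ (toℕ≤m v) (m≤m+n _ _) (+-monoʳ-< (toℕ v) x<y) (+-monoʳ-≤ (toℕ v) y≤m))
    (toℕ≤m u) (toℕ≤m w) eq)

  row-range : ∀ v u → base (toℕ v) ≤ row v u × row v u ≤ base (toℕ v) + m
  row-range v u = window-range (toℕ v) _ (toℕ≤m v) (m≤m+n _ _) (+-monoʳ-≤ (toℕ v) (toℕ≤m u))

  diagonal-injective : Injective _≡_ _≡_ (λ v → row v v)
  diagonal-injective {u} {v} eq =
    toℕ-injective (distinct-on-<⇒injective (λ i → f (i + i)) (diagonal-distinct _ _) (toℕ≤m u) (toℕ≤m v) eq)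

  coloring : TotalColoring (K (suc m))
  coloring = record
    { vcol      = λ v → row v v
    ; ecol      = λ u v _ → row u v
    ; ecol-sym  = λ u v _ _ → cong f (+-comm (toℕ u) (toℕ v))
    ; v-proper  = λ u v u≢v eq → u≢v (diagonal-injective eq)
    ; e-proper  = λ v u w _ _ u≢w eq → u≢w (row-injective v eq)
    ; ve-proper = λ v u v≢u eq → v≢u (row-injective v eq)
    }

  range : ∀ v u → 1 ≤ row v u × row v u ≤ t
  range v u = ≤-trans (proj₁ (base-range _ (toℕ≤m v))) (proj₁ (row-range v u)) ,
              ≤-trans (proj₂ (row-range v u)) (proj₂ (base-range _ (toℕ≤m v)))

  spectrum-⊆ : ∀ v {k} → AtVertex coloring v k → base (toℕ v) ≤ k × k ≤ base (toℕ v) + m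
  spectrum-⊆ v (inj₁ refl)            = row-range v v
  spectrum-⊆ v (inj₂ (u , _ , refl)) = row-range v u

  spectrum-⊇ : ∀ v {k} → base (toℕ v) ≤ k → k ≤ base (toℕ v) + m → AtVertex coloring v k
  spectrum-⊇ v {k} base≤k k≤end
    with injective-into-interval⇒onto (base (toℕ v)) (row v) (row-injective v) (row-range v) k base≤k k≤end
  ... | u , eq with v ≟ u
  ...   | yes refl = inj₁ eq
  ...   | no  v≢u  = inj₂ (u , v≢u , eq)

  spectrum : ∀ v k → (AtVertex coloring v k → base (toℕ v) ≤ k × k ≤ base (toℕ v) + degree (K (suc m)) v) ×
                     (base (toℕ v) ≤ k → k ≤ base (toℕ v) + degree (K (suc m)) v → AtVertex coloring v k)
  spectrum v k rewrite degree-K v = spectrum-⊆ v , spectrum-⊇ v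

  used : ∀ k → 1 ≤ k → k ≤ t → Used coloring k
  used k 1≤k k≤t with covered k 1≤k k≤t
  ... | v , v≤m , base≤k , k≤end
      with spectrum-⊇ (fromℕ< (s≤s v≤m))
             (subst (λ i → base i ≤ k) (sym (toℕ-fromℕ< (s≤s v≤m))) base≤k)
             (subst (λ i → k ≤ base i + m) (sym (toℕ-fromℕ< (s≤s v≤m))) k≤end)
  ...   | inj₁ eq            = inj₁ (fromℕ< (s≤s v≤m) , eq)
  ...   | inj₂ (u , p , eq) = inj₂ (fromℕ< (s≤s v≤m) , u , p , eq)

  SumColoring⇒InT : InT (K (suc m)) t
  SumColoring⇒InT = record
    { col      = coloring
    ; v-range  = λ v → range v v
    ; e-range  = λ u v _ → range u v
    ; all-used = used
    ; interval = λ v → base (toℕ v) , spectrum v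
    }

open FromSumColoring using (SumColoring⇒InT)

max-coloring : ∀ m → SumColoring m (suc (m + m))
max-coloring m = record
  { f                 = suc
  ; base              = suc
  ; window-distinct   = λ _ _ _ _ _ x<y _ eq → <⇒≢ x<y (suc-injective eq)
  ; window-range      = λ _ _ _ v≤x x≤v+m → s≤s v≤x , s≤s x≤v+m
  ; diagonal-distinct = λ _ _ i<j _ eq → <⇒≢ (+-mono-< i<j i<j) (suc-injective eq)
  ; base-range        = λ _ v≤m → s≤s z≤n , s≤s (+-monoˡ-≤ m v≤m)
  ; covered           = covered
  }
  where
  covered : ∀ c → 1 ≤ c → c ≤ suc (m + m) → ∃ λ v → v ≤ m × suc v ≤ c × c ≤ suc v + m
  covered (suc c) _ c≤2m+1 with c ≤? m
  ... | yes c≤m = c , c≤m , ≤-refl , s≤s (m≤m+n c m)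
  ... | no  c≰m = m , ≤-refl , s≤s (<⇒≤ (≰⇒> c≰m)) , c≤2m+1

[i+i]+[1+k+k]≡1+[i+k]+[i+k] : ∀ i k → i + i + suc (k + k) ≡ suc (i + k + (i + k))
[i+i]+[1+k+k]≡1+[i+k]+[i+k] = solve-∀

-- f x = 1 + (x mod n) on [0, 2n): each window is a complete residue system modulo the odd n,
-- and doubling is injective modulo n.
odd-coloring : ∀ k → SumColoring (k + k) (suc (k + k))
odd-coloring k = record
  { f                 = f
  ; base              = λ _ → 1
  ; window-distinct   = window-distinct
  ; window-range      = window-range
  ; diagonal-distinct = diagonal-distinct
  ; base-range        = λ _ _ → ≤-refl , ≤-refl
  ; covered           = λ c 1≤c c≤n → 0 , z≤n , 1≤c , c≤n
  }
  where
  m = k + k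
  n = suc m
  f : ℕ → ℕ
  f x with x <? n
  ... | yes _ = suc x
  ... | no  _ = suc (x ∸ n)
  window-distinct : ∀ v x y → v ≤ m → v ≤ x → x < y → y ≤ v + m → f x ≢ f y
  window-distinct v x y _ v≤x x<y y≤v+m eq with x <? n | y <? n
  ... | yes _   | yes _   = <⇒≢ x<y (suc-injective eq)
  ... | no  x≮n | no  y≮n = <⇒≢ x<y (∸-cancelʳ-≡ (≮⇒≥ x≮n) (≮⇒≥ y≮n) (suc-injective eq))
  ... | no  x≮n | yes y<n = x≮n (<-trans x<y y<n)
  ... | yes _   | no  y≮n =
    <⇒≱ (+-monoʳ-< x (n<1+n m)) (subst (_≤ x + m) y≡x+n (≤-trans y≤v+m (+-monoˡ-≤ m v≤x)))
    where
    y≡x+n : y ≡ x + n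
    y≡x+n = trans (sym (m∸n+n≡m (≮⇒≥ y≮n))) (cong (_+ n) (sym (suc-injective eq)))
  window-range : ∀ v x → v ≤ m → v ≤ x → x ≤ v + m → 1 ≤ f x × f x ≤ 1 + m
  window-range v x v≤m _ x≤v+m with x <? n
  ... | yes x<n = s≤s z≤n , x<n
  ... | no  _   = s≤s z≤n , s≤s (m≤n+o⇒m∸n≤o x n (≤-trans x≤v+m (+-monoˡ-≤ m (m≤n⇒m≤1+n v≤m))))
  diagonal-distinct : ∀ i j → i < j → j ≤ m → f (i + i) ≢ f (j + j)
  diagonal-distinct i j i<j _ eq with i + i <? n | j + j <? n
  ... | yes _   | yes _   = <⇒≢ (+-mono-< i<j i<j) (suc-injective eq)
  ... | no  i≮n | no  j≮n = <⇒≢ (+-mono-< i<j i<j) (∸-cancelʳ-≡ (≮⇒≥ i≮n) (≮⇒≥ j≮n) (suc-injective eq))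
  ... | no  i≮n | yes j<n = i≮n (<-trans (+-mono-< i<j i<j) j<n)
  ... | yes _   | no  j≮n = odd≢even (i + k) j (begin
    suc (i + k + (i + k))  ≡⟨ [i+i]+[1+k+k]≡1+[i+k]+[i+k] i k ⟨
    i + i + n              ≡⟨ cong (_+ n) (suc-injective eq) ⟩
    j + j ∸ n + n          ≡⟨ m∸n+n≡m (≮⇒≥ j≮n) ⟩
    j + j                  ∎)
    where open ≡-Reasoning

[a+a]+[k+k]≡[a+k]+[a+k] : ∀ a k → a + a + (k + k) ≡ a + k + (a + k)
[a+a]+[k+k]≡[a+k]+[a+k] = solve-∀

data EvenOdd : ℕ → Set where
  even : ∀ y → EvenOdd (y + y)
  odd  : ∀ y → EvenOdd (suc (y + y))

evenOdd : ∀ x → EvenOdd x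
evenOdd zero = even 0
evenOdd (suc x) with evenOdd x
... | even y = odd y
... | odd  y = subst EvenOdd (cong suc (+-suc y y)) (even (suc y))

double-injective : ∀ {y y'} → y + y ≡ y' + y' → y ≡ y'
double-injective eq = ≤-antisym (double-≤⇒≤ (≤-reflexive eq)) (double-≤⇒≤ (≤-reflexive (sym eq)))

even<odd⇒≤ : ∀ {a b} → a + a < suc (b + b) → a ≤ b
even<odd⇒≤ lt = double-≤⇒≤ (≤-pred lt)

odd<even⇒< : ∀ {a b} → suc (a + a) < b + b → a < b
odd<even⇒< lt = double-<⇒< (<-trans (n<1+n _) lt)

odd<odd⇒< : ∀ {a b} → suc (a + a) < suc (b + b) → a < b
odd<odd⇒< lt = double-<⇒< (≤-pred lt)

-- For n = 2k the sum 2y gets color E y and 2y + 1 gets O y: E sends [0, k) to [1, k] and [k, 2k)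
-- to [2k + 1, 3k], O sends [0, k) to [k + 1, 2k] and [k, 2k) to [k + 1, 2k].  Vertex 2z starts at
-- z + 1 and vertex 2z + 1 at z + 2, so the spectra sweep [1, 3k].
module EvenColoring (k' : ℕ) where
  k = suc k'
  m = k' + k

  E : ℕ → ℕ
  E y with y <? k
  ... | yes _ = suc y
  ... | no  _ = suc (y + k)

  O : ℕ → ℕ
  O y with y <? k
  ... | yes _ = suc (k + y)
  ... | no  _ = suc y

  f-view : ∀ {x} → EvenOdd x → ℕ
  f-view (even y) = E y
  f-view (odd  y) = O y

  base-view : ∀ {x} → EvenOdd x → ℕ
  base-view (even z) = suc z
  base-view (odd  z) = suc (suc z)

  E-E : ∀ y y' → y < y' → E y ≢ E y'
  E-E y y' y<y' eq with y <? k | y' <? k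
  ... | yes _   | yes _   = <⇒≢ y<y' (suc-injective eq)
  ... | yes y<k | no  _   = <⇒≢ (<-≤-trans y<k (m≤n+m k y')) (suc-injective eq)
  ... | no  y≮k | yes y'<k = y≮k (<-trans y<y' y'<k)
  ... | no  _   | no  _   = <⇒≢ y<y' (+-cancelʳ-≡ k y y' (suc-injective eq))

  O-O : ∀ y y' → y < y' → y' < y + k → O y ≢ O y'
  O-O y y' y<y' y'<y+k eq with y <? k | y' <? k
  ... | yes _   | yes _    = <⇒≢ y<y' (+-cancelˡ-≡ k y y' (suc-injective eq))
  ... | yes _   | no  _    = <⇒≢ y'<y+k (trans (sym (suc-injective eq)) (+-comm k y))
  ... | no  y≮k | yes y'<k = y≮k (<-trans y<y' y'<k)
  ... | no  _   | no  _    = <⇒≢ y<y' (suc-injective eq)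

  E-O : ∀ y y' → y ≤ y' → y' < y + k → E y ≢ O y'
  E-O y y' y≤y' y'<y+k eq with y <? k | y' <? k
  ... | yes y<k | yes _    = <⇒≢ (<-≤-trans y<k (m≤m+n k y')) (suc-injective eq)
  ... | yes y<k | no  y'≮k = y'≮k (subst (_< k) (suc-injective eq) y<k)
  ... | no  y≮k | yes y'<k =
    y≮k (subst (_< k) (sym (+-cancelʳ-≡ k y y' (trans (suc-injective eq) (+-comm k y')))) y'<k)
  ... | no  _   | no  _    = <⇒≢ y'<y+k (sym (suc-injective eq))

  O-E : ∀ y y' → y < y' → O y ≢ E y'
  O-E y y' y<y' eq with y <? k | y' <? k
  ... | yes _   | yes y'<k = <⇒≢ (<-≤-trans y'<k (m≤m+n k y)) (sym (suc-injective eq))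
  ... | yes _   | no  _    = <⇒≢ y<y' (+-cancelʳ-≡ k y y' (trans (+-comm y k) (suc-injective eq)))
  ... | no  _   | yes _    = <⇒≢ y<y' (suc-injective eq)
  ... | no  _   | no  _    = <⇒≢ (<-≤-trans y<y' (m≤m+n y' k)) (suc-injective eq)

  f-view-distinct : ∀ {x x'} (p : EvenOdd x) (p' : EvenOdd x') → x < x' → x' < x + (k + k) →
                    f-view p ≢ f-view p'
  f-view-distinct (even y) (even y') x<x' _ = E-E y y' (double-<⇒< x<x')
  f-view-distinct (odd  y) (odd  y') x<x' x'<x+2k =
    O-O y y' (odd<odd⇒< x<x') (odd<odd⇒< (subst (suc (y' + y') <_) (cong suc ([a+a]+[k+k]≡[a+k]+[a+k] y k)) x'<x+2k))
  f-view-distinct (even y) (odd  y') x<x' x'<x+2k =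
    E-O y y' (even<odd⇒≤ x<x') (odd<even⇒< (subst (suc (y' + y') <_) ([a+a]+[k+k]≡[a+k]+[a+k] y k) x'<x+2k))
  f-view-distinct (odd  y) (even y') x<x' _ = O-E y y' (odd<even⇒< x<x')

  base≥1 : ∀ {v} (p : EvenOdd v) → 1 ≤ base-view p
  base≥1 (even _) = s≤s z≤n
  base≥1 (odd  _) = s≤s z≤n

  base≤1+k : ∀ {v} (p : EvenOdd v) → v < k + k → base-view p ≤ suc k
  base≤1+k (even z) v<2k = m≤n⇒m≤1+n (double-<⇒< v<2k)
  base≤1+k (odd  z) v<2k = s≤s (odd<even⇒< v<2k)

  1+k≤end : ∀ {v} (p : EvenOdd v) → suc k ≤ base-view p + (k + k)
  1+k≤end p = +-mono-≤ (base≥1 p) (m≤m+n k k)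

  base≤E : ∀ {v} (p : EvenOdd v) y → v ≤ y + y → v < k + k → base-view p ≤ E y
  base≤E p y v≤2y v<2k with y <? k
  base≤E (even z) y v≤2y v<2k | yes _ = s≤s (double-≤⇒≤ v≤2y)
  base≤E (odd  z) y v≤2y v<2k | yes _ = s≤s (double-<⇒< v≤2y)
  ... | no _ = ≤-trans (base≤1+k p v<2k) (s≤s (m≤n+m k y))

  base≤O : ∀ {v} (p : EvenOdd v) y → v < k + k → base-view p ≤ O y
  base≤O p y v<2k with y <? k
  ... | yes _   = ≤-trans (base≤1+k p v<2k) (s≤s (m≤m+n k y))
  ... | no  y≮k = ≤-trans (base≤1+k p v<2k) (s≤s (≮⇒≥ y≮k))

  E<end : ∀ {v} (p : EvenOdd v) y → y + y < v + (k + k) → suc (E y) ≤ base-view p + (k + k)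
  E<end p y 2y<end with y <? k
  ... | yes y<k = ≤-trans (s≤s y<k) (1+k≤end p)
  E<end (even z) y 2y<end | no _ =
    ≤-trans (s≤s (+-monoˡ-≤ k (double-<⇒< (subst (y + y <_) ([a+a]+[k+k]≡[a+k]+[a+k] z k) 2y<end))))
            (≤-reflexive (cong suc (+-assoc z k k)))
  E<end (odd  z) y 2y<end | no _ =
    ≤-trans (s≤s (s≤s (+-monoˡ-≤ k (even<odd⇒≤ (subst (y + y <_) (cong suc ([a+a]+[k+k]≡[a+k]+[a+k] z k)) 2y<end)))))
            (≤-reflexive (cong (λ w → suc (suc w)) (+-assoc z k k)))

  O<end : ∀ {v} (p : EvenOdd v) y → suc (y + y) < v + (k + k) → suc (O y) ≤ base-view p + (k + k)
  O<end p y 2y+1<end with y <? k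
  ... | yes y<k = ≤-trans (s≤s (≤-trans (≤-reflexive (sym (+-suc k y))) (+-monoʳ-≤ k y<k)))
                          (+-monoˡ-≤ (k + k) (base≥1 p))
  O<end (even z) y 2y+1<end | no _ =
    ≤-trans (s≤s (odd<even⇒< (subst (suc (y + y) <_) ([a+a]+[k+k]≡[a+k]+[a+k] z k) 2y+1<end)))
            (s≤s (+-monoʳ-≤ z (m≤m+n k k)))
  O<end (odd  z) y 2y+1<end | no _ =
    ≤-trans (s≤s (odd<odd⇒< (subst (suc (y + y) <_) (cong suc ([a+a]+[k+k]≡[a+k]+[a+k] z k)) 2y+1<end)))
            (s≤s (≤-trans (+-monoʳ-≤ z (m≤m+n k k)) (n≤1+n _)))

  f-view-range : ∀ {v x} (p : EvenOdd v) (q : EvenOdd x) → v < k + k → v ≤ x → x < v + (k + k) →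
                 base-view p ≤ f-view q × suc (f-view q) ≤ base-view p + (k + k)
  f-view-range p (even y) v<2k v≤x x<end = base≤E p y v≤x v<2k , E<end p y x<end
  f-view-range p (odd  y) v<2k v≤x x<end = base≤O p y v<2k , O<end p y x<end

  f : ℕ → ℕ
  f x = f-view (evenOdd x)

  base : ℕ → ℕ
  base v = base-view (evenOdd v)

  f-view-even : ∀ {x} (p : EvenOdd x) y → x ≡ y + y → f-view p ≡ E y
  f-view-even (even y') y eq = cong E (double-injective eq)
  f-view-even (odd  y') y eq = contradiction eq (odd≢even y' y)

  base-view-odd : ∀ {x} (p : EvenOdd x) z → x ≡ suc (z + z) → base-view p ≡ suc (suc z)
  base-view-odd (even y') z eq = contradiction (sym eq) (odd≢even z y')
  base-view-odd (odd  y') z eq = cong (λ w → suc (suc w)) (double-injective (suc-injective eq))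

  <+2k : ∀ {v x y} → v ≤ x → y ≤ v + m → y < x + (k + k)
  <+2k {x = x} v≤x y≤v+m = ≤-trans (s≤s (≤-trans y≤v+m (+-monoˡ-≤ m v≤x))) (≤-reflexive (sym (+-suc x m)))

  window-range : ∀ v x → v ≤ m → v ≤ x → x ≤ v + m → base v ≤ f x × f x ≤ base v + m
  window-range v x v≤m v≤x x≤v+m
    with f-view-range (evenOdd v) (evenOdd x) (s≤s v≤m) v≤x (<+2k ≤-refl x≤v+m)
  ... | base≤fx , fx<end = base≤fx , ≤-pred (subst (suc (f x) ≤_) (+-suc (base v) m) fx<end)

  -- Colors beyond 2k = suc m are reached from the odd vertex 2r + 1, whose spectrum ends at 2k + r + 1.
  covered : ∀ c → 1 ≤ c → c ≤ k + k + k → ∃ λ v → v ≤ m × base v ≤ c × c ≤ base v + m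
  covered c 1≤c c≤3k with c ≤? k + k
  ... | yes c≤2k = 0 , z≤n , 1≤c , c≤2k
  ... | no  c≰2k with m≤n⇒∃[o]m+o≡n (≰⇒> c≰2k)
  ...   | r , refl = suc (r + r) , 2r+1≤m ,
                     subst (_≤ suc (k + k) + r) (sym base≡r+2) (s≤s (s≤s (m≤n+m r (k' + k)))) ,
                     subst (λ s → suc (k + k) + r ≤ s + m) (sym base≡r+2) (≤-reflexive (cong (λ w → suc (suc w)) (+-comm m r)))
    where
    r≤k' : r ≤ k'
    r≤k' = +-cancelˡ-≤ (k + k) r k' (≤-pred (≤-trans c≤3k (≤-reflexive (+-suc (k + k) k'))))
    2r+1≤m : suc (r + r) ≤ m
    2r+1≤m = ≤-trans (s≤s (+-mono-≤ r≤k' r≤k')) (≤-reflexive (sym (+-suc k' k')))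
    base≡r+2 : base (suc (r + r)) ≡ suc (suc r)
    base≡r+2 = base-view-odd (evenOdd (suc (r + r))) r refl

  coloring : SumColoring m (k + k + k)
  coloring = record
    { f                 = f
    ; base              = base
    ; window-distinct   = λ v x y _ v≤x x<y y≤v+m → f-view-distinct (evenOdd x) (evenOdd y) x<y (<+2k v≤x y≤v+m)
    ; window-range      = window-range
    ; diagonal-distinct = λ i j i<j _ eq → E-E i j i<j
        (trans (sym (f-view-even (evenOdd (i + i)) i refl)) (trans eq (f-view-even (evenOdd (j + j)) j refl)))
    ; base-range        = λ v v≤m → base≥1 (evenOdd v) ,
        ≤-trans (+-monoˡ-≤ m (base≤1+k (evenOdd v) (s≤s v≤m))) (≤-reflexive (cong suc (+-comm k m)))
    ; covered           = covered
    }

odd-InT : ∀ m k → suc m ≡ 1 + 2 * k → InT (K (suc m)) (suc m)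
odd-InT m k n≡2k+1 = subst (λ m → InT (K (suc m)) (suc m)) (sym m≡k+k) (SumColoring⇒InT (odd-coloring k))
  where
  m≡k+k : m ≡ k + k
  m≡k+k = trans (suc-injective n≡2k+1) (cong (k +_) (+-identityʳ k))

even-InT : ∀ m k → suc m ≡ 2 * k → InT (K (suc m)) (3 * k)
even-InT m (suc k') n≡2k = subst₂ (λ m t → InT (K (suc m)) t) (sym m≡k'+k) (sym (3k≡k+k+k (suc k')))
                              (SumColoring⇒InT (EvenColoring.coloring k'))
  where
  m≡k'+k : m ≡ k' + suc k'
  m≡k'+k = suc-injective (trans n≡2k (cong (suc k' +_) (+-identityʳ (suc k'))))

2[1+m]∸1≡1+m+m : ∀ m → 2 * suc m ∸ 1 ≡ suc (m + m)
2[1+m]∸1≡1+m+m m = trans (cong (m +_) (cong suc (+-identityʳ m))) (+-suc m m)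

open IntervalTotalColoringOfK using (n≤t; t≤2n∸1; even⇒3k≤t)

theorem10 : ∀ m → let n = suc m in
    (∃ λ t → InT (K n) t) ×
    ((∀ k → n ≡ 1 + 2 * k →
        InT (K n) n × (∀ t → InT (K n) t → n ≤ t)) ×
     (∀ k → n ≡ 2 * k →
        InT (K n) (3 * k) × (∀ t → InT (K n) t → 3 * k ≤ t))) ×
    (InT (K n) (2 * n ∸ 1) × (∀ t → InT (K n) t → t ≤ 2 * n ∸ 1))
theorem10 m =
  (suc (m + m) , max-InT) ,
  ((λ k n≡2k+1 → odd-InT m k n≡2k+1 , λ _ φ → n≤t φ) ,
   (λ k n≡2k → even-InT m k n≡2k , λ _ φ → even⇒3k≤t φ k n≡2k)) ,
  (subst (InT (K (suc m))) (sym (2[1+m]∸1≡1+m+m m)) max-InT ,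
   λ t φ → subst (t ≤_) (sym (2[1+m]∸1≡1+m+m m)) (t≤2n∸1 φ))
  where
  max-InT : InT (K (suc m)) (suc (m + m))
  max-InT = SumColoring⇒InT (max-coloring m)
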